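{- For every $d\ge 2$ there is no strategy-proof algorithm (mechanism) that finds a stable matching in the $d$-attribute model.
   Context: A matching market consists of $n$ men and $n$ women. In the $d$-attribute model each participant $p$ has attributes $A_1(p),\dots,A_d(p)$ and weights $\alpha_1(p),\dots,\alpha_d(p)$; a man $m$ values a woman $w$ by $\sum_{i=1}^d\alpha_i(m)A_i(w)$ and prefers larger values, and symmetrically for women. A matching $\mu$ is stable if there is no pair $(m,w)\notin\mu$ with $m$ strictly preferring $w$ to $\mu(m)$ and $w$ strictly preferring $m$ to $\mu(w)$. A mechanism takes the reported weight vectors of all participants (attributes are fixed and cannot be misreported) and outputs a matching stable with respect to the reported preferences. It is strategy-proof if no participant can ever obtain a partner he or she strictly prefers (according to the true weights) by reporting a different weight vector while all others report truthfully. -}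

module Defs where

open import Data.Nat using (ℕ; zero; suc)
open import Data.Fin using (Fin; zero; suc; _≟_)
open import Data.Fin.Permutation using (Permutation′; _⟨$⟩ʳ_; _⟨$⟩ˡ_)
open import Data.Rational using (ℚ; 0ℚ; _+_; _*_; _<_)
open import Data.Product using (Σ; _×_)
open import Relation.Nullary using (¬_; does)
open import Relation.Binary.PropositionalEquality using (_≡_; _≢_)
open import Data.Bool using (if_then_else_)

Vecℚ : ℕ → Set
Vecℚ d = Fin d → ℚ

dot : ∀ {d} → Vecℚ d → Vecℚ d → ℚ
dot {zero}  _ _ = 0ℚ
dot {suc d} a b = a zero * b zero + dot (λ i → a (suc i)) (λ i → b (suc i))

-- Fixed (non-reportable) attributes of the n men and n women.
record Market (n d : ℕ) : Set where
  field
    attrM : Fin n → Vecℚ d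
    attrW : Fin n → Vecℚ d

record Profile (n d : ℕ) : Set where
  constructor profile
  field
    wtM : Fin n → Vecℚ d
    wtW : Fin n → Vecℚ d
open Profile public

-- A perfect matching: a bijection men → women.
Matching : ℕ → Set
Matching n = Permutation′ n

partnerM : ∀ {n} → Matching n → Fin n → Fin n
partnerM μ m = μ ⟨$⟩ʳ m

partnerW : ∀ {n} → Matching n → Fin n → Fin n
partnerW μ w = μ ⟨$⟩ˡ w

valM : ∀ {n d} → Market n d → Profile n d → Fin n → Fin n → ℚ
valM mk P m w = dot (wtM P m) (Market.attrW mk w)

valW : ∀ {n d} → Market n d → Profile n d → Fin n → Fin n → ℚ
valW mk P w m = dot (wtW P w) (Market.attrM mk m)

Stable : ∀ {n d} → Market n d → Profile n d → Matching n → Set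
Stable {n} mk P μ =
  (m w : Fin n) → partnerM μ m ≢ w →
  ¬ ( (valM mk P m (partnerM μ m) < valM mk P m w)
    × (valW mk P w (partnerW μ w) < valW mk P w m) )

update : ∀ {n} {A : Set} → (Fin n → A) → Fin n → A → Fin n → A
update f i x j = if does (j ≟ i) then x else f j

Mechanism : ℕ → Set
Mechanism d = (n : ℕ) → Market n d → Profile n d → Matching n

AlwaysStable : ∀ {d} → Mechanism d → Set
AlwaysStable {d} M = (n : ℕ) (mk : Market n d) (P : Profile n d) → Stable mk P (M n mk P)

StrategyProof : ∀ {d} → Mechanism d → Set
StrategyProof {d} M =
  (n : ℕ) (mk : Market n d) (P : Profile n d) →
  ((m : Fin n) (α : Vecℚ d) →
     ¬ (valM mk P m (partnerM (M n mk P) m)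
         < valM mk P m (partnerM (M n mk (profile (update (wtM P) m α) (wtW P))) m)))
  × ((w : Fin n) (α : Vecℚ d) →
     ¬ (valW mk P w (partnerW (M n mk P) w)
         < valW mk P w (partnerW (M n mk (profile (wtM P) (update (wtW P) w α))) w)))

module Submission where

-- Take three men and three women whose preferences, realised with two attributes, admit exactly two stable
-- matchings: the man-optimal one, in which m₁ gets his favourite w₁ and w₀ gets m₂, and the woman-optimal one,
-- in which w₀ gets her favourite m₁.  If m₁ reports a weight vector ranking w₀ last, or w₀
-- one ranking m₂ last, only the liar's preferred matching stays stable.  Whichever of the two the mechanism
-- returns on the truthful profile, one of these two lies therefore pays off.  The claims about the example are
-- decided by enumerating all assignments of three women to three men, and padding all vectors with zeros
-- embeds the example into any dimension d ≥ 2.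

open import Defs
open import Data.Nat using (ℕ; _≤_; _+_; zero; suc; s≤s; z≤n)
open import Data.Fin using (Fin; zero; suc; _≟_)
open import Data.Fin.Properties using (all?)
open import Data.Fin.Permutation using (inverseˡ)
open import Data.Vec.Functional using (_∷_; [])
open import Data.Rational using (ℚ; 0ℚ; _*_; _<_) renaming (_+_ to _+ℚ_)
open import Data.Nat.Literals as ℕ using ()
open import Data.Rational.Literals as ℚ using ()
open import Agda.Builtin.FromNat using (Number; fromNat)
open import Data.Unit using (tt)  -- instance solving the trivial Number constraints of literals
open import Data.Rational.Properties using (_<?_; <-irrefl; *-zeroʳ; +-identityʳ)
open import Data.Product using (Σ; _×_; _,_; proj₁; proj₂)
open import Data.Sum as Sum using (_⊎_; inj₁; inj₂)
open import Data.Bool using (true; false)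
open import Function using (_∘_)
open import Function.Definitions using (Injective)
open import Relation.Nullary using (¬_; does; Dec)
open import Relation.Nullary.Decidable using (¬?; _×-dec_; _⊎-dec_; _→-dec_; map′; from-yes)
open import Relation.Binary.PropositionalEquality
  using (_≡_; _≗_; refl; sym; trans; cong; cong₂; subst₂)

instance
  ℕ-number : Number ℕ
  ℕ-number = ℕ.number

  ℚ-number : Number ℚ
  ℚ-number = ℚ.number

private
  variable
    n d k : ℕ

deviateM : Profile n d → Fin n → Vecℚ d → Profile n d
deviateM P m α = profile (update (wtM P) m α) (wtW P)

deviateW : Profile n d → Fin n → Vecℚ d → Profile n d
deviateW P w β = profile (wtM P) (update (wtW P) w β)

ManProfits : Market n d → Profile n d → Fin n → Vecℚ d → Matching n → Set
ManProfits {n} mk P m α μ = (μ′ : Matching n) → Stable mk (deviateM P m α) μ′ →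
  valM mk P m (partnerM μ m) < valM mk P m (partnerM μ′ m)

WomanProfits : Market n d → Profile n d → Fin n → Vecℚ d → Matching n → Set
WomanProfits {n} mk P w β μ = (μ′ : Matching n) → Stable mk (deviateW P w β) μ′ →
  valW mk P w (partnerW μ w) < valW mk P w (partnerW μ′ w)

no-stable-strategyProof-mechanism :
  (mk : Market n d) (P : Profile n d) (m : Fin n) (α : Vecℚ d) (w : Fin n) (β : Vecℚ d) →
  ((μ : Matching n) → Stable mk P μ → ManProfits mk P m α μ ⊎ WomanProfits mk P w β μ) →
  ¬ Σ (Mechanism d) (λ M → AlwaysStable M × StrategyProof M)
no-stable-strategyProof-mechanism {n} mk P m α w β profits (M , stable , sp)
  with profits (M n mk P) (stable n mk P)
... | inj₁ man   = proj₁ (sp n mk P) m α (man (M n mk (deviateM P m α)) (stable n mk _))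
... | inj₂ woman = proj₂ (sp n mk P) w β (woman (M n mk (deviateW P w β)) (stable n mk _))

-- Women are addressed through their partners f m′, which presupposes that f is a bijection.
NoBlockingPair : (Fin n → Fin n → ℚ) → (Fin n → Fin n → ℚ) → (Fin n → Fin n) → Set
NoBlockingPair u v f = ∀ m m′ → ¬ (u m (f m) < u m (f m′) × v (f m′) m′ < v (f m′) m)

partnerW-partnerM : (μ : Matching n) {m w : Fin n} → partnerM μ m ≡ w → partnerW μ w ≡ m
partnerW-partnerM μ refl = inverseˡ μ

partnerM-injective : (μ : Matching n) → Injective _≡_ _≡_ (partnerM μ)
partnerM-injective μ e = trans (sym (partnerW-partnerM μ refl)) (partnerW-partnerM μ (sym e))

-- The side condition partnerM μ m ≢ w of Stable is automatic: no man strictly prefers his partner to herself.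
stable⇒noBlockingPair : (mk : Market n d) (P : Profile n d) (μ : Matching n) →
  Stable mk P μ → NoBlockingPair (valM mk P) (valW mk P) (partnerM μ)
stable⇒noBlockingPair mk P μ st m m′ (gain , gain′) =
  st m (partnerM μ m′) (λ e → <-irrefl (cong (valM mk P m) e) gain)
     (gain , subst₂ _<_ (cong (valW mk P (partnerM μ m′)) (sym (inverseˡ μ))) refl gain′)

noBlockingPair-resp : {u u′ v v′ : Fin n → Fin n → ℚ} {f g : Fin n → Fin n} →
  (∀ m w → u m w ≡ u′ m w) → (∀ w m → v w m ≡ v′ w m) → f ≗ g →
  NoBlockingPair u v f → NoBlockingPair u′ v′ g
noBlockingPair-resp {f = f} {g} u≡ v≡ f≗g nbp m m′
  rewrite sym (f≗g m) | sym (f≗g m′)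
        | sym (u≡ m (f m)) | sym (u≡ m (f m′)) | sym (v≡ (f m′) m′) | sym (v≡ (f m′) m)
  = nbp m m′

injective? : (f : Fin n → Fin n) → Dec (Injective _≡_ _≡_ f)
injective? f = map′ (λ inj {i} {j} → inj i j) (λ inj i j → inj)
  (all? λ i → all? λ j → (f i ≟ f j) →-dec (i ≟ j))

noBlockingPair? : (u v : Fin n → Fin n → ℚ) (f : Fin n → Fin n) → Dec (NoBlockingPair u v f)
noBlockingPair? u v f = all? λ m → all? λ m′ →
  ¬? ((u m (f m) <? u m (f m′)) ×-dec (v (f m′) m′ <? v (f m′) m))

module _ (u v : Fin 3 → Fin 3 → ℚ) (G : Fin 3 → Fin 3 → Fin 3 → Set) where

  StableAssignmentsSatisfy : Set
  StableAssignmentsSatisfy = ∀ a b c →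
    Injective _≡_ _≡_ (a ∷ b ∷ c ∷ []) → NoBlockingPair u v (a ∷ b ∷ c ∷ []) → G a b c

  stableAssignmentsSatisfy? : (∀ a b c → Dec (G a b c)) → Dec StableAssignmentsSatisfy
  stableAssignmentsSatisfy? G? = all? λ a → all? λ b → all? λ c →
    injective? (a ∷ b ∷ c ∷ []) →-dec noBlockingPair? u v (a ∷ b ∷ c ∷ []) →-dec G? a b c

  stableAssignmentsSatisfy⇒ : StableAssignmentsSatisfy → (f : Fin 3 → Fin 3) →
    Injective _≡_ _≡_ f → NoBlockingPair u v f → G (f zero) (f (suc zero)) (f (suc (suc zero)))
  stableAssignmentsSatisfy⇒ sat f inj nbp = sat _ _ _
    (λ e → inj (trans (f≗table _) (trans e (sym (f≗table _)))))
    (noBlockingPair-resp {u = u} {v = v} (λ _ _ → refl) (λ _ _ → refl) f≗table nbp)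
    where
    f≗table : f ≗ (f zero ∷ f (suc zero) ∷ f (suc (suc zero)) ∷ [])
    f≗table zero             = refl
    f≗table (suc zero)       = refl
    f≗table (suc (suc zero)) = refl

pad : Vecℚ d → Vecℚ (d + k)
pad {zero}  a _       = 0ℚ
pad {suc d} a zero    = a zero
pad {suc d} a (suc i) = pad (a ∘ suc) i

dot-zeroʳ : (a : Vecℚ d) → dot a (λ _ → 0ℚ) ≡ 0ℚ
dot-zeroʳ {zero}  a = refl
dot-zeroʳ {suc d} a = trans (cong₂ _+ℚ_ (*-zeroʳ (a zero)) (dot-zeroʳ (a ∘ suc))) (+-identityʳ 0ℚ)

dot-pad : (a b : Vecℚ d) → dot (pad {k = k} a) (pad b) ≡ dot a b
dot-pad {zero} {k} a b = dot-zeroʳ {k} (λ _ → 0ℚ)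
dot-pad {suc d} a b = cong (a zero * b zero +ℚ_) (dot-pad (a ∘ suc) (b ∘ suc))

padMarket : Market n d → Market n (d + k)
padMarket mk = record { attrM = pad ∘ Market.attrM mk ; attrW = pad ∘ Market.attrW mk }

padProfile : Profile n d → Profile n (d + k)
padProfile P = profile (pad ∘ wtM P) (pad ∘ wtW P)

_Pads_ : Profile n (d + k) → Profile n d → Set
Q′ Pads Q = (∀ m → wtM Q′ m ≡ pad (wtM Q m)) × (∀ w → wtW Q′ w ≡ pad (wtW Q w))

padProfile-pads : (P : Profile n d) → padProfile {k = k} P Pads P
padProfile-pads P = (λ _ → refl) , (λ _ → refl)

update-pads : {f : Fin n → Vecℚ (d + k)} {g : Fin n → Vecℚ d} (i : Fin n) (x : Vecℚ d) →
  (∀ j → f j ≡ pad (g j)) → ∀ j → update f i (pad x) j ≡ pad (update g i x j)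
update-pads i x f≡ j with does (j ≟ i)
... | true  = refl
... | false = f≡ j

deviateM-pads : {Q′ : Profile n (d + k)} {Q : Profile n d} (m : Fin n) (α : Vecℚ d) →
  Q′ Pads Q → deviateM Q′ m (pad α) Pads deviateM Q m α
deviateM-pads m α (M≡ , W≡) = update-pads m α M≡ , W≡

deviateW-pads : {Q′ : Profile n (d + k)} {Q : Profile n d} (w : Fin n) (β : Vecℚ d) →
  Q′ Pads Q → deviateW Q′ w (pad β) Pads deviateW Q w β
deviateW-pads w β (M≡ , W≡) = M≡ , update-pads w β W≡

module _ {n d k : ℕ} (mk : Market n d) {Q′ : Profile n (d + k)} {Q : Profile n d} (pads : Q′ Pads Q) where

  valM-pad : ∀ m w → valM (padMarket mk) Q′ m w ≡ valM mk Q m w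
  valM-pad m w = trans (cong (λ a → dot a (pad (Market.attrW mk w))) (proj₁ pads m))
                       (dot-pad {k = k} (wtM Q m) _)

  valW-pad : ∀ w m → valW (padMarket mk) Q′ w m ≡ valW mk Q w m
  valW-pad w m = trans (cong (λ a → dot a (pad (Market.attrM mk m))) (proj₂ pads w))
                       (dot-pad {k = k} (wtW Q w) _)

  stable-pad⇒noBlockingPair : (μ : Matching n) → Stable (padMarket mk) Q′ μ →
    NoBlockingPair (valM mk Q) (valW mk Q) (partnerM μ)
  stable-pad⇒noBlockingPair μ st =
    noBlockingPair-resp valM-pad valW-pad (λ _ → refl) (stable⇒noBlockingPair (padMarket mk) Q′ μ st)

m₀ m₁ m₂ w₀ w₁ : Fin 3
m₀ = zero
m₁ = suc zero
m₂ = suc (suc zero)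
w₀ = zero
w₁ = suc zero

market : Market 3 2
market = record
  { attrM = (0 ∷ 1 ∷ []) ∷ (0 ∷ 2 ∷ []) ∷ (2 ∷ 0 ∷ []) ∷ []
  ; attrW = (1 ∷ 2 ∷ []) ∷ (3 ∷ 1 ∷ []) ∷ (3 ∷ 0 ∷ []) ∷ []
  }

truth : Profile 3 2
truth = profile
  ((0 ∷ 1 ∷ []) ∷ (2 ∷ 3 ∷ []) ∷ (0 ∷ 2 ∷ []) ∷ [])
  ((2 ∷ 3 ∷ []) ∷ (3 ∷ 2 ∷ []) ∷ (1 ∷ 3 ∷ []) ∷ [])

lie₁ lie₀ : Vecℚ 2
lie₁ = 2 ∷ 1 ∷ []
lie₀ = 0 ∷ 1 ∷ []

StableOutcomesSatisfy : Profile 3 2 → (Fin 3 → Fin 3 → Fin 3 → Set) → Set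
StableOutcomesSatisfy Q = StableAssignmentsSatisfy (valM market Q) (valW market Q)

stableOutcomesSatisfy? : ∀ Q {G} → (∀ a b c → Dec (G a b c)) → Dec (StableOutcomesSatisfy Q G)
stableOutcomesSatisfy? Q {G} = stableAssignmentsSatisfy? (valM market Q) (valW market Q) G

truth-outcomes : StableOutcomesSatisfy truth λ _ b c → b ≡ w₀ ⊎ c ≡ w₀
truth-outcomes = from-yes (stableOutcomesSatisfy? truth λ _ b c → (b ≟ w₀) ⊎-dec (c ≟ w₀))

lie₁-outcomes : StableOutcomesSatisfy (deviateM truth m₁ lie₁) λ _ b _ → b ≡ w₁
lie₁-outcomes = from-yes (stableOutcomesSatisfy? (deviateM truth m₁ lie₁) λ _ b _ → b ≟ w₁)

lie₀-outcomes : StableOutcomesSatisfy (deviateW truth w₀ lie₀) λ _ b _ → b ≡ w₀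
lie₀-outcomes = from-yes (stableOutcomesSatisfy? (deviateW truth w₀ lie₀) λ _ b _ → b ≟ w₀)

m₁-prefers-w₁ : valM market truth m₁ w₀ < valM market truth m₁ w₁
m₁-prefers-w₁ = from-yes (valM market truth m₁ w₀ <? valM market truth m₁ w₁)

w₀-prefers-m₁ : valW market truth w₀ m₂ < valW market truth w₀ m₁
w₀-prefers-m₁ = from-yes (valW market truth w₀ m₂ <? valW market truth w₀ m₁)

module _ {k : ℕ} where

  paddedMarket : Market 3 (2 + k)
  paddedMarket = padMarket market

  paddedTruth : Profile 3 (2 + k)
  paddedTruth = padProfile truth

  stable-outcome : {Q′ : Profile 3 (2 + k)} (Q : Profile 3 2) {G : Fin 3 → Fin 3 → Fin 3 → Set} →
    Q′ Pads Q → StableOutcomesSatisfy Q G → (μ : Matching 3) → Stable paddedMarket Q′ μ →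
    G (partnerM μ m₀) (partnerM μ m₁) (partnerM μ m₂)
  stable-outcome Q {G} pads sat μ st =
    stableAssignmentsSatisfy⇒ (valM market Q) (valW market Q) G sat (partnerM μ)
    (partnerM-injective μ) (stable-pad⇒noBlockingPair market pads μ st)

  paddedTruth-pads : paddedTruth Pads truth
  paddedTruth-pads = padProfile-pads truth

  valM-partner : (ν : Matching 3) {w : Fin 3} → partnerM ν m₁ ≡ w →
    valM market truth m₁ w ≡ valM paddedMarket paddedTruth m₁ (partnerM ν m₁)
  valM-partner ν e =
    sym (trans (valM-pad market paddedTruth-pads m₁ (partnerM ν m₁)) (cong (valM market truth m₁) e))

  valW-partner : (ν : Matching 3) {m : Fin 3} → partnerW ν w₀ ≡ m →
    valW market truth w₀ m ≡ valW paddedMarket paddedTruth w₀ (partnerW ν w₀)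
  valW-partner ν e =
    sym (trans (valW-pad market paddedTruth-pads w₀ (partnerW ν w₀)) (cong (valW market truth w₀) e))

  m₁-profits : (μ : Matching 3) → partnerM μ m₁ ≡ w₀ → ManProfits paddedMarket paddedTruth m₁ (pad lie₁) μ
  m₁-profits μ e μ′ st′ = subst₂ _<_ (valM-partner μ e)
    (valM-partner μ′
      (stable-outcome (deviateM truth m₁ lie₁) (deviateM-pads m₁ lie₁ paddedTruth-pads) lie₁-outcomes μ′ st′))
    m₁-prefers-w₁

  w₀-profits : (μ : Matching 3) → partnerW μ w₀ ≡ m₂ → WomanProfits paddedMarket paddedTruth w₀ (pad lie₀) μ
  w₀-profits μ e μ′ st′ = subst₂ _<_ (valW-partner μ e)
    (valW-partner μ′ (partnerW-partnerM μ′
      (stable-outcome (deviateW truth w₀ lie₀) (deviateW-pads w₀ lie₀ paddedTruth-pads) lie₀-outcomes μ′ st′)))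
    w₀-prefers-m₁

  profitable-misreport : (μ : Matching 3) → Stable paddedMarket paddedTruth μ →
    ManProfits paddedMarket paddedTruth m₁ (pad lie₁) μ ⊎ WomanProfits paddedMarket paddedTruth w₀ (pad lie₀) μ
  profitable-misreport μ st = Sum.map (m₁-profits μ) (w₀-profits μ ∘ partnerW-partnerM μ)
    (stable-outcome truth paddedTruth-pads truth-outcomes μ st)

corollary1 : (d : ℕ) → 2 ≤ d →
    ¬ Σ (Mechanism d) (λ M → AlwaysStable M × StrategyProof M)
corollary1 (suc (suc k)) (s≤s (s≤s z≤n)) =
  no-stable-strategyProof-mechanism paddedMarket paddedTruth m₁ (pad lie₁) w₀ (pad lie₀) profitable-misreport
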